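{- Let $(\mathcal D,\bar\epsilon)$ be a local operator-system, $(F,e)$ a $\mathcal D$-field, and $r$ of HS-iteration type with HS-coefficients $(c^{ij}_\ell)$. If there exists a $\mathcal D^r$-ring $(R,e)$ in which the operators $(\partial_1,\dots,\partial_m)$ are $F$-linearly independent as functions $R\to R$, then $r$ is associative.
   Context: Let $k$ be a field. A local operator-system $(\mathcal D,\bar\epsilon)$: $\mathcal D$ a finite-dimensional commutative local $k$-algebra with maximal ideal $\mathfrak m$ and residue field $k$, $\dim_k\mathcal D=m+1$, $\bar\epsilon=(1,\epsilon_1,\dots,\epsilon_m)$ a ranked basis (consecutive blocks lie in $\mathfrak m^j$ and project to bases of $\mathfrak m^j/\mathfrak m^{j+1}$). $\alpha^{pq}_i\in k$ is the coefficient of $\epsilon_i$ in $\epsilon_p\epsilon_q$. A $\mathcal D$-ring is a $k$-algebra $R$ with a $k$-algebra homomorphism $e:R\to\mathcal D\otimes_kR$, $e(x)=1\otimes x+\sum_i\epsilon_i\otimes\partial_i(x)$. All rings are $F$-algebras and $\mathcal D$-rings are $\mathcal D$-algebras over $(F,e)$. $r:\mathcal D\to\mathcal D\otimes_k\mathcal D\otimes_kF$ is of HS-iteration type with HS-coefficients $c^{ij}_\ell\in F$ if it is a $k$-algebra homomorphism with $r(\epsilon_\ell)=\epsilon_\ell\otimes1\otimes1+1\otimes\epsilon_\ell\otimes1+\sum_{i,j}\epsilon_i\otimes\epsilon_j\otimes c^{ij}_\ell$. A $\mathcal D^r$-ring is a $\mathcal D$-ring (over $F$) with $\partial_i\partial_j=\sum_\ell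 c^{ij}_\ell\partial_\ell$ for all $i,j$. $r$ is associative if for all $1\le i,j,k,s\le m$: $\sum_\ell\big(c^{ij}_\ell c^{\ell k}_s-c^{jk}_\ell c^{i\ell}_s-\sum_{p,q}\alpha^{pq}_i\partial_p(c^{jk}_\ell)c^{q\ell}_s\big)=\partial_i(c^{jk}_s)$, with $\partial_p$ the operators of $F$. -}

module Defs where

open import Level using (Level; _⊔_) renaming (suc to lsuc)
open import Data.Nat as ℕ using (ℕ; _≤_; _<_; _∸_)
open import Data.Fin using (Fin; zero; suc; _≟_) renaming (_≤_ to _≤ᶠ_)
open import Data.Product using (Σ; ∃; _×_; _,_)
open import Relation.Nullary using (¬_; yes; no)
open import Algebra.Bundles using (CommutativeRing)
open import Algebra.Morphism.Structures using (module RingMorphisms)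

private
  variable
    c ℓ a ℓa f ℓf : Level

module _ (R : CommutativeRing c ℓ) where
  open CommutativeRing R using (Carrier; _≈_; _+_; _*_; 0#; 1#)

  ∑ : ∀ {n} → (Fin n → Carrier) → Carrier
  ∑ {ℕ.zero}  g = 0#
  ∑ {ℕ.suc n} g = g zero + ∑ (λ i → g (suc i))

  δ : ∀ {n} → Fin n → Fin n → Carrier
  δ i j with i ≟ j
  ... | yes _ = 1#
  ... | no  _ = 0#

  record IsField : Set (c ⊔ ℓ) where
    field
      1≉0     : ¬ (1# ≈ 0#)
      inverse : ∀ x → ¬ (x ≈ 0#) → ∃ λ y → x * y ≈ 1#

IsRingHom : (A : CommutativeRing a ℓa) (B : CommutativeRing c ℓ) →
            (CommutativeRing.Carrier A → CommutativeRing.Carrier B) → Set _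
IsRingHom A B h =
  RingMorphisms.IsRingHomomorphism (CommutativeRing.rawRing A) (CommutativeRing.rawRing B) h

-- Local operator-system (D, ε̄) over k, in coordinates.
-- D = k^(m+1) with basis b₀ = 1, b_(suc i) = ε_(i+1) (i : Fin m);
-- μ p q t = coefficient of b_t in b_p b_q.

record LocalOperatorSystem (k : CommutativeRing c ℓ) (m : ℕ) : Set (c ⊔ ℓ) where
  open CommutativeRing k using (Carrier; _≈_; _+_; _*_; 0#; 1#)
  field
    μ      : Fin (ℕ.suc m) → Fin (ℕ.suc m) → Fin (ℕ.suc m) → Carrier
    unitˡ  : ∀ q t → μ zero q t ≈ δ k q t
    comm   : ∀ p q t → μ p q t ≈ μ q p t
    assoc  : ∀ p q s t →
             ∑ k (λ i → μ p q i * μ i s t) ≈ ∑ k (λ i → μ q s i * μ p i t)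
    rk        : Fin m → ℕ
    rk-pos    : ∀ i → 1 ≤ rk i
    rk-mono   : ∀ i j → i ≤ᶠ j → rk i ≤ rk j
    -- 𝔪 = span{ε_i} is an ideal:
    ideal     : ∀ p q → μ (suc p) (suc q) zero ≈ 0#
    -- 𝔪^a 𝔪^b ⊆ span{rank ≥ a + b}:
    filtered  : ∀ p q t → rk t < rk p ℕ.+ rk q → μ (suc p) (suc q) (suc t) ≈ 0#
    -- each ε_t of rank j ≥ 2 lies in 𝔪 · span{rank ≥ j - 1}:
    generated : ∀ t → 2 ≤ rk t →
                Σ (Fin m → Fin m → Carrier) λ λ' →
                  (∀ p q → rk q < rk t ∸ 1 → λ' p q ≈ 0#) ×
                  (∀ s → ∑ k (λ p → ∑ k (λ q → λ' p q * μ (suc p) (suc q) s))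
                           ≈ δ k (suc t) s)

  α : Fin m → Fin m → Fin m → Carrier
  α p q i = μ (suc p) (suc q) (suc i)

-- D-ring structure on a commutative ring A which is a k-algebra via κ:
-- the operators ∂_i are exactly such that
-- e(x) = 1 ⊗ x + Σ ε_i ⊗ ∂_i x  is a k-algebra homomorphism A → D ⊗ A.

module _ {k : CommutativeRing c ℓ} {m : ℕ} (D : LocalOperatorSystem k m) where
  open LocalOperatorSystem D using (α)

  record IsDRing (A : CommutativeRing a ℓa)
                 (κ : CommutativeRing.Carrier k → CommutativeRing.Carrier A)
                 (∂ : Fin m → CommutativeRing.Carrier A → CommutativeRing.Carrier A)
                 : Set (c ⊔ a ⊔ ℓa) where
    open CommutativeRing A using (Carrier; _≈_; _+_; _*_; 0#; 1#)
    field
      ∂-cong : ∀ i {x y} → x ≈ y → ∂ i x ≈ ∂ i y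
      ∂-+    : ∀ i x y → ∂ i (x + y) ≈ ∂ i x + ∂ i y
      ∂-1    : ∀ i → ∂ i 1# ≈ 0#
      ∂-k    : ∀ i r x → ∂ i (κ r * x) ≈ κ r * ∂ i x
      ∂-*    : ∀ i x y → ∂ i (x * y) ≈
                 (∂ i x * y + x * ∂ i y)
                 + ∑ A (λ p → ∑ A (λ q → κ (α p q i) * (∂ p x * ∂ q y)))

  record DField f ℓf : Set (c ⊔ ℓ ⊔ lsuc (f ⊔ ℓf)) where
    field
      F       : CommutativeRing f ℓf
      isField : IsField F
      ι       : CommutativeRing.Carrier k → CommutativeRing.Carrier F
      ι-hom   : IsRingHom k F ι
      ∂F      : Fin m → CommutativeRing.Carrier F → CommutativeRing.Carrier F
      isDRing : IsDRing F ι ∂F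

  module _ {f ℓf} (𝔽 : DField f ℓf) where
    open DField 𝔽
    private module F = CommutativeRing F
    open LocalOperatorSystem D using (μ)

    -- elements of D ⊗_k D ⊗_k F, in coordinates w.r.t. the basis b_a ⊗ b_b
    Tensor : Set f
    Tensor = Fin (ℕ.suc m) → Fin (ℕ.suc m) → F.Carrier

    _⊛_ : Tensor → Tensor → Tensor
    (X ⊛ Y) t u =
      ∑ F (λ a₁ → ∑ F (λ b₁ → ∑ F (λ a₂ → ∑ F (λ b₂ →
        X a₁ b₁ F.* Y a₂ b₂ F.* ι (μ a₁ a₂ t) F.* ι (μ b₁ b₂ u)))))

    -- the values of r on the basis b_p of D, given HS-coefficients c^{ij}_ℓ
    -- (r(1) = 1⊗1⊗1, r(ε_ℓ) = ε_ℓ⊗1⊗1 + 1⊗ε_ℓ⊗1 + Σ ε_i⊗ε_j⊗c^{ij}_ℓ);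
    -- r itself is the k-linear extension.
    rBasis : (Fin m → Fin m → Fin m → F.Carrier) → Fin (ℕ.suc m) → Tensor
    rBasis cc zero    a       b       = δ F a zero F.* δ F b zero
    rBasis cc (suc l) zero    zero    = F.0#
    rBasis cc (suc l) (suc i) zero    = δ F i l
    rBasis cc (suc l) zero    (suc j) = δ F j l
    rBasis cc (suc l) (suc i) (suc j) = cc i j l

    -- r is of HS-iteration type with HS-coefficients cc: the k-linear map
    -- r determined by rBasis is a k-algebra homomorphism (it is unital by
    -- construction; multiplicativity on basis elements):
    IsHSIterationType : (Fin m → Fin m → Fin m → F.Carrier) → Set ℓf
    IsHSIterationType cc =
      ∀ p q t u → (rBasis cc p ⊛ rBasis cc q) t u
                  F.≈ ∑ F (λ s → ι (μ p q s) F.* rBasis cc s t u)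

    IsAssociative : (Fin m → Fin m → Fin m → F.Carrier) → Set ℓf
    IsAssociative cc =
      ∀ i j k' s →
        ∑ F (λ l → (cc i j l F.* cc l k' s F.- cc j k' l F.* cc i l s)
                   F.- ∑ F (λ p → ∑ F (λ q →
                         ι (LocalOperatorSystem.α D p q i)
                           F.* ∂F p (cc j k' l) F.* cc q l s)))
        F.≈ ∂F i (cc j k' s)

    record DAlgebra a ℓa : Set (c ⊔ f ⊔ ℓf ⊔ lsuc (a ⊔ ℓa)) where
      field
        R       : CommutativeRing a ℓa
        φ       : F.Carrier → CommutativeRing.Carrier R
        φ-hom   : IsRingHom F R φ
        ∂       : Fin m → CommutativeRing.Carrier R → CommutativeRing.Carrier R
        isDRing : IsDRing R (λ r → φ (ι r)) ∂
        ∂-φ     : ∀ i x → CommutativeRing._≈_ R (∂ i (φ x)) (φ (∂F i x))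

    record DrRing (cc : Fin m → Fin m → Fin m → F.Carrier) a ℓa
                  : Set (c ⊔ f ⊔ ℓf ⊔ lsuc (a ⊔ ℓa)) where
      field
        dAlg : DAlgebra a ℓa
      open DAlgebra dAlg
      field
        iterate : ∀ i j x → CommutativeRing._≈_ R (∂ i (∂ j x))
                    (∑ R (λ l → CommutativeRing._*_ R (φ (cc i j l)) (∂ l x)))

    OperatorsLinearlyIndependent : ∀ {cc} → DrRing cc a ℓa → Set _
    OperatorsLinearlyIndependent {cc = cc} Rr =
      ∀ (λ' : Fin m → F.Carrier) →
        (∀ x → CommutativeRing._≈_ R
                 (∑ R (λ i → CommutativeRing._*_ R (φ (λ' i)) (∂ i x)))
                 (CommutativeRing.0# R)) →
        ∀ i → λ' i F.≈ F.0#
      where open DAlgebra (DrRing.dAlg Rr)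

-- Expand ∂ᵢ∂ⱼ∂ₖ x in two ways. Read as (∂ᵢ∂ⱼ)∂ₖ, the D^r-relations give
-- Σₛ (Σₗ c^{ij}_l c^{lk}_s) ∂ₛ x. Read as ∂ᵢ(∂ⱼ∂ₖ) = ∂ᵢ(Σₗ c^{jk}_l ∂ₗ x), the
-- twisted Leibniz rule of the D-ring produces ∂ᵢ(c^{jk}_s), Σₗ c^{jk}_l c^{il}_s
-- and the α-cross terms as coefficients of ∂ₛ x. Both are F-linear
-- combinations of ∂₁ … ∂ₘ, so linear independence equates the coefficients,
-- and that equation is the associativity identity.
module Submission where

open import Defs
open import Level using (Level)
open import Data.Nat using (ℕ)
open import Data.Fin using (Fin)
open import Data.Product using (Σ)
open import Algebra.Bundles using (CommutativeRing)

open import Data.Fin using (zero; suc)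
open import Data.Product using (_,_)
open import Function using (_∘_)
open import Relation.Binary.PropositionalEquality as ≡ using (_≡_)
import Relation.Binary.Reasoning.Setoid as SetoidReasoning
open import Algebra.Morphism.Structures using (module RingMorphisms)

module _ {a ℓa b ℓb} (A : CommutativeRing a ℓa) (B : CommutativeRing b ℓb) where
  private
    module A = CommutativeRing A
    module B = CommutativeRing B

  ∑-homo : ∀ {h : A.Carrier → B.Carrier} →
           (∀ x y → h (x A.+ y) B.≈ h x B.+ h y) → h A.0# B.≈ B.0# →
           ∀ {n} (g : Fin n → A.Carrier) → h (∑ A g) B.≈ ∑ B (h ∘ g)
  ∑-homo +-homo 0-homo {ℕ.zero}  g = 0-homo
  ∑-homo +-homo 0-homo {ℕ.suc n} g =
    B.trans (+-homo _ _) (B.+-congˡ (∑-homo +-homo 0-homo (g ∘ suc)))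

module SumProperties {c ℓ} (R : CommutativeRing c ℓ) where
  open CommutativeRing R hiding (zero)
  open import Algebra.Properties.Semiring.Sum semiring as Sum using (sum)
  open import Algebra.Properties.AbelianGroup +-abelianGroup using (⁻¹-∙-comm; xyx⁻¹≈y)
  open import Algebra.Properties.Group +-group using (ε⁻¹≈ε)
  open SetoidReasoning setoid

  -- Defs' ∑ unfolds like the library's sum, but only after splitting on the length.
  ∑≡sum : ∀ {n} (g : Fin n → Carrier) → ∑ R g ≡ sum g
  ∑≡sum {ℕ.zero}  g = ≡.refl
  ∑≡sum {ℕ.suc n} g = ≡.cong (g zero +_) (∑≡sum (g ∘ suc))

  ∑-cong : ∀ {n} {g h : Fin n → Carrier} → (∀ i → g i ≈ h i) → ∑ R g ≈ ∑ R h
  ∑-cong {g = g} {h} g≈h rewrite ∑≡sum g | ∑≡sum h = Sum.sum-cong-≋ g≈h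

  ∑-distrib-+ : ∀ {n} (g h : Fin n → Carrier) → ∑ R (λ i → g i + h i) ≈ ∑ R g + ∑ R h
  ∑-distrib-+ g h rewrite ∑≡sum (λ i → g i + h i) | ∑≡sum g | ∑≡sum h = Sum.∑-distrib-+ g h

  ∑-distrib-- : ∀ {n} (g h : Fin n → Carrier) → ∑ R (λ i → g i - h i) ≈ ∑ R g - ∑ R h
  ∑-distrib-- g h = trans (∑-distrib-+ g (-_ ∘ h))
    (+-congˡ (sym (∑-homo R R (λ x y → sym (⁻¹-∙-comm x y)) ε⁻¹≈ε h)))

  *-distribˡ-∑ : ∀ {n} x (g : Fin n → Carrier) → x * ∑ R g ≈ ∑ R (λ i → x * g i)
  *-distribˡ-∑ x g rewrite ∑≡sum g | ∑≡sum (λ i → x * g i) = Sum.*-distribˡ-sum x g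

  *-distribʳ-∑ : ∀ {n} x (g : Fin n → Carrier) → ∑ R g * x ≈ ∑ R (λ i → g i * x)
  *-distribʳ-∑ x g rewrite ∑≡sum g | ∑≡sum (λ i → g i * x) = Sum.*-distribʳ-sum x g

  ∑-comm : ∀ {m n} (g : Fin m → Fin n → Carrier) →
           ∑ R (λ i → ∑ R (g i)) ≈ ∑ R (λ j → ∑ R (λ i → g i j))
  ∑-comm g = begin
    ∑ R (λ i → ∑ R (g i))             ≈⟨ ∑-cong (λ i → reflexive (∑≡sum (g i))) ⟩
    ∑ R (λ i → sum (g i))             ≡⟨ ∑≡sum (λ i → sum (g i)) ⟩
    sum (λ i → sum (g i))             ≈⟨ Sum.∑-comm g ⟩
    sum (λ j → sum (λ i → g i j))     ≡⟨ ∑≡sum (λ j → sum (λ i → g i j)) ⟨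
    ∑ R (λ j → sum (λ i → g i j))     ≈⟨ ∑-cong (λ j → reflexive (∑≡sum (λ i → g i j))) ⟨
    ∑ R (λ j → ∑ R (λ i → g i j))     ∎

  [x+y+z-y]-z≈x : ∀ x y z → ((x + y + z) - y) - z ≈ x
  [x+y+z-y]-z≈x x y z = begin
    ((x + y + z) - y) - z     ≈⟨ +-congʳ (+-congʳ (trans (+-congʳ (+-comm x y)) (+-assoc y x z))) ⟩
    ((y + (x + z)) - y) - z   ≈⟨ +-congʳ (xyx⁻¹≈y y (x + z)) ⟩
    (x + z) - z               ≈⟨ +-assoc x z (- z) ⟩
    x + (z - z)               ≈⟨ +-congˡ (-‿inverseʳ z) ⟩
    x + 0#                    ≈⟨ +-identityʳ x ⟩
    x                         ∎

module DAlgebraProperties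
  {c ℓ f ℓf a ℓa} {K : CommutativeRing c ℓ} {m : ℕ} {D : LocalOperatorSystem K m}
  {𝔽 : DField D f ℓf} (A : DAlgebra D 𝔽 a ℓa) where
  open DField 𝔽 using (F; ι; ∂F)
  open DAlgebra A
  open LocalOperatorSystem D using (α)
  open IsDRing isDRing
  open CommutativeRing R hiding (zero)
  open SumProperties R
  open import Algebra.Properties.Ring ring using (x+x≈x⇒x≈0; [y-z]x≈yx-zx)
  open SetoidReasoning setoid
  private
    module F = CommutativeRing F
    module φ = RingMorphisms.IsRingHomomorphism φ-hom

  φ-∑ : ∀ {n} (g : Fin n → F.Carrier) → φ (∑ F g) ≈ ∑ R (φ ∘ g)
  φ-∑ = ∑-homo F R φ.+-homo φ.0#-homo

  ∂-0 : ∀ i → ∂ i 0# ≈ 0#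
  ∂-0 i = x+x≈x⇒x≈0 _ (trans (sym (∂-+ i 0# 0#)) (∂-cong i (+-identityʳ 0#)))

  ∂-∑ : ∀ i {n} (g : Fin n → Carrier) → ∂ i (∑ R g) ≈ ∑ R (∂ i ∘ g)
  ∂-∑ i = ∑-homo R R (∂-+ i) (∂-0 i)

  ∂-φ* : ∀ i b y →
         ∂ i (φ b * y) ≈ (φ (∂F i b) * y + φ b * ∂ i y)
                         + ∑ R (λ p → ∑ R (λ q → φ (ι (α p q i) F.* ∂F p b) * ∂ q y))
  ∂-φ* i b y = trans (∂-* i (φ b) y)
    (+-cong (+-congʳ (*-congʳ (∂-φ i b)))
            (∑-cong λ p → ∑-cong λ q → begin
              φ (ι (α p q i)) * (∂ p (φ b) * ∂ q y)      ≈⟨ *-congˡ (*-congʳ (∂-φ p b)) ⟩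
              φ (ι (α p q i)) * (φ (∂F p b) * ∂ q y)     ≈⟨ *-assoc _ _ _ ⟨
              φ (ι (α p q i)) * φ (∂F p b) * ∂ q y       ≈⟨ *-congʳ (φ.*-homo _ _) ⟨
              φ (ι (α p q i) F.* ∂F p b) * ∂ q y         ∎))

  combination : (Fin m → F.Carrier) → Carrier → Carrier
  combination a x = ∑ R (λ s → φ (a s) * ∂ s x)

  combination-+ : ∀ a b x →
                  combination (λ s → a s F.+ b s) x ≈ combination a x + combination b x
  combination-+ a b x = begin
    ∑ R (λ s → φ (a s F.+ b s) * ∂ s x)                ≈⟨ ∑-cong (λ s → *-congʳ (φ.+-homo (a s) (b s))) ⟩
    ∑ R (λ s → (φ (a s) + φ (b s)) * ∂ s x)            ≈⟨ ∑-cong (λ s → distribʳ (∂ s x) (φ (a s)) (φ (b s))) ⟩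
    ∑ R (λ s → φ (a s) * ∂ s x + φ (b s) * ∂ s x)      ≈⟨ ∑-distrib-+ (λ s → φ (a s) * ∂ s x) _ ⟩
    combination a x + combination b x                  ∎

  combination-- : ∀ a b x →
                  combination (λ s → a s F.- b s) x ≈ combination a x - combination b x
  combination-- a b x = begin
    ∑ R (λ s → φ (a s F.- b s) * ∂ s x)                ≈⟨ ∑-cong (λ s → *-congʳ (φ-- (a s) (b s))) ⟩
    ∑ R (λ s → (φ (a s) - φ (b s)) * ∂ s x)            ≈⟨ ∑-cong (λ s → [y-z]x≈yx-zx (∂ s x) (φ (a s)) (φ (b s))) ⟩
    ∑ R (λ s → φ (a s) * ∂ s x - φ (b s) * ∂ s x)      ≈⟨ ∑-distrib-- (λ s → φ (a s) * ∂ s x) _ ⟩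
    combination a x - combination b x                  ∎
    where
    φ-- : ∀ u v → φ (u F.- v) ≈ φ u - φ v
    φ-- u v = trans (φ.+-homo u (F.- v)) (+-congˡ (φ.-‿homo v))

  *-combination : ∀ b a x → φ b * combination a x ≈ combination (λ s → b F.* a s) x
  *-combination b a x = begin
    φ b * ∑ R (λ s → φ (a s) * ∂ s x)                  ≈⟨ *-distribˡ-∑ (φ b) (λ s → φ (a s) * ∂ s x) ⟩
    ∑ R (λ s → φ b * (φ (a s) * ∂ s x))                ≈⟨ ∑-cong (λ s → *-assoc (φ b) (φ (a s)) (∂ s x)) ⟨
    ∑ R (λ s → φ b * φ (a s) * ∂ s x)                  ≈⟨ ∑-cong (λ s → *-congʳ (φ.*-homo b (a s))) ⟨
    combination (λ s → b F.* a s) x                    ∎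

  ∑-combination : ∀ {n} (a : Fin n → Fin m → F.Carrier) x →
                  ∑ R (λ l → combination (a l) x) ≈ combination (λ s → ∑ F (λ l → a l s)) x
  ∑-combination a x = begin
    ∑ R (λ l → ∑ R (λ s → φ (a l s) * ∂ s x))          ≈⟨ ∑-comm (λ l s → φ (a l s) * ∂ s x) ⟩
    ∑ R (λ s → ∑ R (λ l → φ (a l s) * ∂ s x))          ≈⟨ ∑-cong (λ s → *-distribʳ-∑ (∂ s x) (λ l → φ (a l s))) ⟨
    ∑ R (λ s → ∑ R (λ l → φ (a l s)) * ∂ s x)          ≈⟨ ∑-cong (λ s → *-congʳ (φ-∑ (λ l → a l s))) ⟨
    combination (λ s → ∑ F (λ l → a l s)) x            ∎

module DrRingProperties
  {c ℓ f ℓf a ℓa} {K : CommutativeRing c ℓ} {m : ℕ} {D : LocalOperatorSystem K m}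
  {𝔽 : DField D f ℓf} {cc : Fin m → Fin m → Fin m → CommutativeRing.Carrier (DField.F 𝔽)}
  (Rr : DrRing D 𝔽 cc a ℓa) where
  open DField 𝔽 using (F; ι; ∂F)
  open DrRing Rr using (dAlg; iterate)
  open DAlgebra dAlg
  open DAlgebraProperties dAlg
  open LocalOperatorSystem D using (α)
  open IsDRing isDRing using (∂-cong)
  open CommutativeRing R hiding (zero)
  open SumProperties R
  open SetoidReasoning setoid
  private
    module F = CommutativeRing F

  leibnizCross : Fin m → F.Carrier → Fin m → Fin m → F.Carrier
  leibnizCross i b l s = ∑ F (λ p → ∑ F (λ q → ι (α p q i) F.* ∂F p b F.* cc q l s))

  combination-∂ : ∀ a k x →
                  combination a (∂ k x) ≈ combination (λ s → ∑ F (λ l → a l F.* cc l k s)) x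
  combination-∂ a k x = begin
    ∑ R (λ l → φ (a l) * ∂ l (∂ k x))                  ≈⟨ ∑-cong (λ l → *-congˡ (iterate l k x)) ⟩
    ∑ R (λ l → φ (a l) * combination (cc l k) x)       ≈⟨ ∑-cong (λ l → *-combination (a l) (cc l k) x) ⟩
    ∑ R (λ l → combination (λ s → a l F.* cc l k s) x) ≈⟨ ∑-combination (λ l s → a l F.* cc l k s) x ⟩
    combination (λ s → ∑ F (λ l → a l F.* cc l k s)) x ∎

  ∂-φ*∂ : ∀ i b l x →
          ∂ i (φ b * ∂ l x) ≈ (φ (∂F i b) * ∂ l x + combination (λ s → b F.* cc i l s) x)
                              + combination (leibnizCross i b l) x
  ∂-φ*∂ i b l x = begin
    ∂ i (φ b * ∂ l x)
      ≈⟨ ∂-φ* i b (∂ l x) ⟩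
    (φ (∂F i b) * ∂ l x + φ b * ∂ i (∂ l x))
      + ∑ R (λ p → ∑ R (λ q → φ (ι (α p q i) F.* ∂F p b) * ∂ q (∂ l x)))
      ≈⟨ +-cong (+-congˡ (*-congˡ (iterate i l x)))
                (∑-cong λ p → ∑-cong λ q → *-congˡ {φ (ι (α p q i) F.* ∂F p b)} (iterate q l x)) ⟩
    (φ (∂F i b) * ∂ l x + φ b * combination (cc i l) x)
      + ∑ R (λ p → ∑ R (λ q → φ (ι (α p q i) F.* ∂F p b) * combination (cc q l) x))
      ≈⟨ +-cong (+-congˡ (*-combination b (cc i l) x))
                (∑-cong λ p → ∑-cong λ q → *-combination (ι (α p q i) F.* ∂F p b) (cc q l) x) ⟩
    (φ (∂F i b) * ∂ l x + combination (λ s → b F.* cc i l s) x)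
      + ∑ R (λ p → ∑ R (λ q → combination (λ s → ι (α p q i) F.* ∂F p b F.* cc q l s) x))
      ≈⟨ +-congˡ (trans (∑-cong λ p → ∑-combination (λ q s → ι (α p q i) F.* ∂F p b F.* cc q l s) x)
                        (∑-combination (λ p s → ∑ F (λ q → ι (α p q i) F.* ∂F p b F.* cc q l s)) x)) ⟩
    (φ (∂F i b) * ∂ l x + combination (λ s → b F.* cc i l s) x)
      + combination (leibnizCross i b l) x
      ∎

  ∂-combination : ∀ i a x →
                  ∂ i (combination a x)
                  ≈ combination (λ s → (∂F i (a s) F.+ ∑ F (λ l → a l F.* cc i l s))
                                       F.+ ∑ F (λ l → leibnizCross i (a l) l s)) x
  ∂-combination i a x = begin
    ∂ i (∑ R (λ l → φ (a l) * ∂ l x))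
      ≈⟨ ∂-∑ i (λ l → φ (a l) * ∂ l x) ⟩
    ∑ R (λ l → ∂ i (φ (a l) * ∂ l x))
      ≈⟨ ∑-cong (λ l → ∂-φ*∂ i (a l) l x) ⟩
    ∑ R (λ l → (φ (∂F i (a l)) * ∂ l x + combination (λ s → a l F.* cc i l s) x)
               + combination (leibnizCross i (a l) l) x)
      ≈⟨ trans (∑-distrib-+ (λ l → φ (∂F i (a l)) * ∂ l x + combination (λ s → a l F.* cc i l s) x) _)
               (+-congʳ (∑-distrib-+ (λ l → φ (∂F i (a l)) * ∂ l x) _)) ⟩
    (combination (∂F i ∘ a) x + ∑ R (λ l → combination (λ s → a l F.* cc i l s) x))
      + ∑ R (λ l → combination (leibnizCross i (a l) l) x)
      ≈⟨ +-cong (+-congˡ (∑-combination (λ l s → a l F.* cc i l s) x))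
                (∑-combination (λ l → leibnizCross i (a l) l) x) ⟩
    (combination (∂F i ∘ a) x + combination (λ s → ∑ F (λ l → a l F.* cc i l s)) x)
      + combination (λ s → ∑ F (λ l → leibnizCross i (a l) l s)) x
      ≈⟨ trans (+-congʳ (sym (combination-+ _ _ x))) (sym (combination-+ _ _ x)) ⟩
    combination (λ s → (∂F i (a s) F.+ ∑ F (λ l → a l F.* cc i l s))
                       F.+ ∑ F (λ l → leibnizCross i (a l) l s)) x
      ∎

  combination-injective : OperatorsLinearlyIndependent D 𝔽 Rr →
                          ∀ {a b} → (∀ x → combination a x ≈ combination b x) →
                          ∀ s → a s F.≈ b s
  combination-injective independent {a} {b} a≈b s =
    x∙y⁻¹≈ε⇒x≈y (a s) (b s)
      (independent (λ s → a s F.- b s) (λ x → trans (combination-- a b x) (x≈y⇒x∙y⁻¹≈ε (a≈b x))) s)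
    where
    open import Algebra.Properties.Group F.+-group using (x∙y⁻¹≈ε⇒x≈y)
    open import Algebra.Properties.Group +-group using (x≈y⇒x∙y⁻¹≈ε)

  iterate-assoc-coefficients :
    OperatorsLinearlyIndependent D 𝔽 Rr → ∀ i j k s →
    ∑ F (λ l → cc i j l F.* cc l k s)
    F.≈ (∂F i (cc j k s) F.+ ∑ F (λ l → cc j k l F.* cc i l s))
        F.+ ∑ F (λ l → leibnizCross i (cc j k l) l s)
  iterate-assoc-coefficients independent i j k = combination-injective independent λ x → begin
    combination (λ s → ∑ F (λ l → cc i j l F.* cc l k s)) x   ≈⟨ combination-∂ (cc i j) k x ⟨
    combination (cc i j) (∂ k x)                               ≈⟨ iterate i j (∂ k x) ⟨
    ∂ i (∂ j (∂ k x))                                          ≈⟨ ∂-cong i (iterate j k x) ⟩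
    ∂ i (combination (cc j k) x)                               ≈⟨ ∂-combination i (cc j k) x ⟩
    combination (λ s → (∂F i (cc j k s) F.+ ∑ F (λ l → cc j k l F.* cc i l s))
                       F.+ ∑ F (λ l → leibnizCross i (cc j k l) l s)) x ∎

proposition4p12 : ∀ {c ℓ f ℓf a ℓa : Level}
    (k : CommutativeRing c ℓ) → IsField k →
    (m : ℕ) (D : LocalOperatorSystem k m) (𝔽 : DField D f ℓf) →
    (cc : Fin m → Fin m → Fin m → CommutativeRing.Carrier (DField.F 𝔽)) →
    IsHSIterationType D 𝔽 cc →
    Σ (DrRing D 𝔽 cc a ℓa) (OperatorsLinearlyIndependent D 𝔽) →
    IsAssociative D 𝔽 cc
proposition4p12 _ _ m _ 𝔽 cc _ (Rr , independent) i j k' s = begin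
  ∑ F (λ l → (ij·k l F.- jk·i l) F.- leibnizCross i (cc j k' l) l s)
    ≈⟨ trans (∑-distrib-- (λ l → ij·k l F.- jk·i l) _) (+-congʳ (∑-distrib-- ij·k jk·i)) ⟩
  (∑ F ij·k F.- ∑ F jk·i) F.- ∑ F (λ l → leibnizCross i (cc j k' l) l s)
    ≈⟨ +-congʳ (+-congʳ (iterate-assoc-coefficients independent i j k' s)) ⟩
  (((∂F i (cc j k' s) F.+ ∑ F jk·i) F.+ ∑ F (λ l → leibnizCross i (cc j k' l) l s)) F.- ∑ F jk·i)
    F.- ∑ F (λ l → leibnizCross i (cc j k' l) l s)
    ≈⟨ [x+y+z-y]-z≈x _ _ _ ⟩
  ∂F i (cc j k' s) ∎
  where
  open DField 𝔽 using (F; ∂F)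
  module F = CommutativeRing F
  open F using (trans; +-congʳ; setoid)
  open SumProperties F
  open DrRingProperties Rr
  open SetoidReasoning setoid
  ij·k jk·i : Fin m → F.Carrier
  ij·k l = cc i j l F.* cc l k' s
  jk·i l = cc j k' l F.* cc i l s
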